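{- Let $\vec b=(b_0,b_1,\dots)$ be an infinite sequence of integers. For every integer $n\ge1$, $\widehat{C}^{\vec b}_{5,6,n}=\widehat{C}^{\vec b}_{5,7,n}=(b_0b_4)^n$.
   Context: A $k$-dimensional balanced ballot path of length $kn$ is a sequence of $kn$ standard unit vectors of $\mathbb{R}^k$, each $\vec e_i$ occurring exactly $n$ times, such that every intermediate point (partial sum) $\vec x=(x_1,\dots,x_k)$ satisfies $x_1\ge\cdots\ge x_k$. The semisymmetric height of $\vec x$ is $g_k(\vec x)=\sum_{i=1}^k(k+1-2i)x_i$ and the semisymmetric height $g_k(P)$ of a path is the maximum of $g_k$ over its intermediate points. Steps $\vec e_i$ with $i\le\lfloor k/2\rfloor$ are semisymmetric up-steps. For a sequence $\vec b$, the weight $sswt_{\vec b}(P)$ is the product, over all up-steps of $P$, of $b_h$ where $h$ is the semisymmetric height of the starting point of that up-step. Define $\widehat{C}^{\vec b}_{k,u,n}=\sum_P sswt_{\vec b}(P)$, summed over all $k$-dimensional balanced ballot paths of length $kn$ with $g_k(P)\le u$. -}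

module Defs where

open import Data.Bool using (Bool; true; false; if_then_else_; _∧_)
open import Data.Nat as ℕ using (ℕ; zero; suc; _∸_; _≤ᵇ_; _<ᵇ_; _/_)
open import Data.Fin using (Fin; toℕ; _≟_)
open import Data.Integer as ℤ using (ℤ; +_; _-_; _⊔_; ∣_∣)
open import Data.List using (List; []; _∷_; map; foldr; filter; filterᵇ; allFin; concatMap; length)
open import Data.Bool.ListAction using (and)
open import Data.Vec.Functional using (Vector; updateAt)

-- A lattice point of ℕ^k (coordinates indexed 0..k-1, i.e. x_{i+1} = x i).
Point : ℕ → Set
Point k = Vector ℕ k

origin : ∀ {k} → Point k
origin _ = 0

step : ∀ {k} → Point k → Fin k → Point k
step x i = updateAt x i suc

Path : ℕ → Set
Path k = List (Fin k)

points : ∀ {k} → Point k → Path k → List (Point k)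
points x []      = x ∷ []
points x (i ∷ p) = x ∷ points (step x i) p

sumℤ : List ℤ → ℤ
sumℤ = foldr ℤ._+_ (+ 0)

productℤ : List ℤ → ℤ
productℤ = foldr ℤ._*_ (+ 1)

-- Semisymmetric height g_k(x) = Σ_{i=1}^k (k+1-2i) x_i ; with 0-based index j = i-1
-- the coefficient is k-1-2j.
g : ∀ k → Point k → ℤ
g k x = sumℤ (map (λ j → ((+ (k ∸ 1)) - (+ (2 ℕ.* toℕ j))) ℤ.* (+ x j)) (allFin k))

isWeaklyDecreasing : ∀ {k} → Point k → Bool
isWeaklyDecreasing {k} x =
  and (concatMap (λ i → map (λ j → if toℕ i ≤ᵇ toℕ j then x j ≤ᵇ x i else true) (allFin k)) (allFin k))

count : ∀ {k} → Fin k → Path k → ℕ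
count i p = length (filter (i ≟_) p)

isBalanced : ∀ {k} → ℕ → Path k → Bool
isBalanced {k} n p = and (map (λ i → count i p ℕ.≡ᵇ n) (allFin k))

isBallot : ∀ {k} → Path k → Bool
isBallot p = and (map isWeaklyDecreasing (points origin p))

-- Semisymmetric height of a path: maximum of g_k over its points
-- (the origin is among them and has g = 0, so starting the max at 0 is harmless).
heightPath : ∀ k → Path k → ℤ
heightPath k p = foldr _⊔_ (+ 0) (map (g k) (points origin p))

-- Semisymmetric up-step: e_i with i ≤ ⌊k/2⌋ (1-based), i.e. 0-based index < ⌊k/2⌋.
isUpStep : ∀ {k} → Fin k → Bool
isUpStep {k} i = toℕ i <ᵇ (k / 2)

-- Weight: product over up-steps of b_h, h = semisymmetric height of the step's start point.
-- (For ballot paths h ≥ 0, so ∣ h ∣ = h.)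
sswtFrom : ∀ {k} → (ℕ → ℤ) → Point k → Path k → ℤ
sswtFrom b x []      = + 1
sswtFrom {k} b x (i ∷ p) =
  (if isUpStep i then b ∣ g k x ∣ else + 1) ℤ.* sswtFrom b (step x i) p

sswt : ∀ {k} → (ℕ → ℤ) → Path k → ℤ
sswt b p = sswtFrom b origin p

words : ∀ k → ℕ → List (Path k)
words k zero    = [] ∷ []
words k (suc m) = concatMap (λ w → map (_∷ w) (allFin k)) (words k m)

boundedBallotPaths : ∀ k → (u n : ℕ) → List (Path k)
boundedBallotPaths k u n =
  filterᵇ (λ p → isBalanced n p ∧ isBallot p ∧ (heightPath k p ℤ.≤ᵇ + u)) (words k (k ℕ.* n))

Chat : (b : ℕ → ℤ) (k u n : ℕ) → ℤ
Chat b k u n = sumℤ (map (sswt b) (boundedBallotPaths k u n))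

-- Translating a point by (s, …, s) changes neither the ballot condition, nor g₅ (its coefficients
-- 4, 2, 0, −2, −4 sum to 0), nor the weights.  Up to such translations a ballot path of height ≤ 7
-- is forced: from the point e₁ + ⋯ + e_r (0 ≤ r < 5) the only step keeping the path weakly decreasing
-- with g₅ ≤ 7 is e_{r+1}, and this cycle never rises above height 6.  So for u ∈ {6, 7} the only
-- path counted is (e₁e₂e₃e₄e₅)ⁿ, whose up-steps e₁ and e₂ start at heights 0 and 4.
module Submission where

open import Defs
open import Data.Nat using (ℕ; _≤_)
open import Data.Integer using (ℤ; _*_; _^_)
open import Data.Product using (_×_)
open import Relation.Binary.PropositionalEquality using (_≡_)

open import Data.Bool using (Bool; true; T; _∧_; if_then_else_)
open import Data.Bool.ListAction using (and)
open import Data.Bool.Properties using (T-∧)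
open import Data.Fin as Fin using (Fin; toℕ)
open import Data.Fin.Properties using (all?)
open import Data.Integer as ℤ using (_+_; _-_; +_; +≤+)
import Data.Integer.Properties as ℤ
open import Data.Integer.Tactic.RingSolver using (solve-∀)
open import Data.List
  using ([]; _∷_; _++_; map; concatMap; filter; length; allFin; cartesianProductWith)
open import Data.List.Properties
  using ( foldr-forcesᵇ; foldr-preservesᵇ; map-cong; concatMap-cong; map-tabulate
        ; filter-accept; filter-reject; filter-none)
open import Data.List.Membership.Propositional using (_∈_)
open import Data.List.Membership.Propositional.Properties
  using (∈-allFin; ∈-cartesianProductWith⁺; ∈-cartesianProductWith⁻)
open import Data.List.Relation.Unary.All as All using (All; []; _∷_)
open import Data.List.Relation.Unary.All.Properties as All using (all⁺; all⁻)
open import Data.List.Relation.Unary.Any using (here; there)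
open import Data.List.Relation.Unary.AllPairs using ([]; _∷_)
open import Data.List.Relation.Unary.Unique.Propositional using (Unique)
open import Data.List.Relation.Unary.Unique.Propositional.Properties
  using (cartesianProductWith⁺; allFin⁺)
import Data.Nat as ℕ
import Data.Nat.Properties as ℕ
open import Data.Product using (_,_; proj₂; uncurry)
open import Data.Vec.Functional.Properties using (updateAt-updates; updateAt-minimal)
open import Function using (_∘_; _$_; flip; _⇔_; mk⇔; Equivalence)
open import Relation.Binary.PropositionalEquality
  using (refl; sym; trans; cong; cong₂; subst; module ≡-Reasoning)
open import Relation.Nullary using (yes; no)
open import Relation.Nullary.Decidable using (Dec; T?; _×-dec_; _→-dec_; from-yes; map′)
open import Relation.Unary using (Decidable)

open ≡-Reasoning

record Shifted {k} (s : ℕ) (x y : Point k) : Set where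
  constructor shifted
  field coordinate : ∀ i → x i ≡ s ℕ.+ y i

open Shifted

step-shift : ∀ {k s} {x y : Point k} → Shifted s x y → ∀ i → Shifted s (step x i) (step y i)
step-shift {s = s} {x} {y} x≈y i = shifted step-coordinate
  where
  step-coordinate : ∀ j → step x i j ≡ s ℕ.+ step y i j
  step-coordinate j with j Fin.≟ i
  ... | yes refl = begin
    step x i i         ≡⟨ updateAt-updates i x ⟩
    ℕ.suc (x i)        ≡⟨ cong ℕ.suc (coordinate x≈y i) ⟩
    ℕ.suc (s ℕ.+ y i)  ≡⟨ ℕ.+-suc s (y i) ⟨
    s ℕ.+ ℕ.suc (y i)  ≡⟨ cong (s ℕ.+_) (updateAt-updates i y) ⟨
    s ℕ.+ step y i i   ∎
  ... | no j≢i = begin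
    step x i j        ≡⟨ updateAt-minimal j i x j≢i ⟩
    x j               ≡⟨ coordinate x≈y j ⟩
    s ℕ.+ y j         ≡⟨ cong (s ℕ.+_) (updateAt-minimal j i y j≢i) ⟨
    s ℕ.+ step y i j  ∎

Shifted-trans : ∀ {k s t} {x y z : Point k} → Shifted s x y → Shifted t y z → Shifted (s ℕ.+ t) x z
Shifted-trans {s = s} {t} {x} {y} {z} x≈y y≈z = shifted λ i → begin
  x i               ≡⟨ coordinate x≈y i ⟩
  s ℕ.+ y i         ≡⟨ cong (s ℕ.+_) (coordinate y≈z i) ⟩
  s ℕ.+ (t ℕ.+ z i) ≡⟨ ℕ.+-assoc s t (z i) ⟨
  s ℕ.+ t ℕ.+ z i   ∎

+-cancelˡ-≤ᵇ : ∀ s m n → (s ℕ.+ m ℕ.≤ᵇ s ℕ.+ n) ≡ (m ℕ.≤ᵇ n)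
+-cancelˡ-≤ᵇ ℕ.zero    m n = refl
+-cancelˡ-≤ᵇ (ℕ.suc s) m n = trans (suc-≤ᵇ (s ℕ.+ m) (s ℕ.+ n)) (+-cancelˡ-≤ᵇ s m n)
  where
  suc-≤ᵇ : ∀ m n → (ℕ.suc m ℕ.≤ᵇ ℕ.suc n) ≡ (m ℕ.≤ᵇ n)
  suc-≤ᵇ ℕ.zero    n = refl
  suc-≤ᵇ (ℕ.suc m) n = refl

isWeaklyDecreasing-shift : ∀ {k s} {x y : Point k} → Shifted s x y →
                           isWeaklyDecreasing x ≡ isWeaklyDecreasing y
isWeaklyDecreasing-shift {k} {s} {x} {y} x≈y =
  cong and (concatMap-cong (λ i → map-cong (λ j → cong (if _ then_else true) (≤ᵇ-shift j i)) (allFin k))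
                           (allFin k))
  where
  ≤ᵇ-shift : ∀ i j → (x i ℕ.≤ᵇ x j) ≡ (y i ℕ.≤ᵇ y j)
  ≤ᵇ-shift i j rewrite coordinate x≈y i | coordinate x≈y j = +-cancelˡ-≤ᵇ s (y i) (y j)

sumℤ-map-*-+ : ∀ {A : Set} (w : A → ℤ) (c : ℤ) (h : A → ℤ) xs →
               sumℤ (map (λ a → w a * (c + h a)) xs)
                 ≡ c * sumℤ (map w xs) + sumℤ (map (λ a → w a * h a) xs)
sumℤ-map-*-+ w c h []       = sym (trans (ℤ.+-identityʳ _) (ℤ.*-zeroʳ c))
sumℤ-map-*-+ w c h (a ∷ xs) =
  trans (cong (λ S → w a * (c + h a) + S) (sumℤ-map-*-+ w c h xs)) (distrib (w a) c (h a) _ _)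
  where
  distrib : ∀ w c h S T → w * (c + h) + (c * S + T) ≡ c * (w + S) + (w * h + T)
  distrib = solve-∀

map-allFin-suc : ∀ {A : Set} {k} (f : Fin (ℕ.suc k) → A) →
                 map f (allFin (ℕ.suc k)) ≡ f Fin.zero ∷ map (f ∘ Fin.suc) (allFin k)
map-allFin-suc f =
  cong (f Fin.zero ∷_) (trans (map-tabulate Fin.suc f) (sym (map-tabulate (λ j → j) (f ∘ Fin.suc))))

sumℤ-arithmeticProgression : ∀ a k →
  sumℤ (map (λ j → a - + (2 ℕ.* toℕ j)) (allFin k)) ≡ + k * (a - + k + + 1)
sumℤ-arithmeticProgression a ℕ.zero    = refl
sumℤ-arithmeticProgression a (ℕ.suc k) = begin
  sumℤ (map (λ j → a - + (2 ℕ.* toℕ j)) (allFin (ℕ.suc k)))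
    ≡⟨ cong sumℤ (map-allFin-suc {k = k} (λ j → a - + (2 ℕ.* toℕ j))) ⟩
  a - + 0 + sumℤ (map (λ j → a - + (2 ℕ.* ℕ.suc (toℕ j))) (allFin k))
    ≡⟨ cong (λ S → a - + 0 + sumℤ S) (map-cong (λ j → shift-by-2 (toℕ j)) (allFin k)) ⟩
  a - + 0 + sumℤ (map (λ j → (a - + 2) - + (2 ℕ.* toℕ j)) (allFin k))
    ≡⟨ cong (λ S → a - + 0 + S) (sumℤ-arithmeticProgression (a - + 2) k) ⟩
  a - + 0 + + k * ((a - + 2) - + k + + 1)
    ≡⟨ closed-form a (+ k) ⟩
  + ℕ.suc k * (a - + ℕ.suc k + + 1) ∎
  where
  split-subtrahend : ∀ a X → a - (+ 2 + X) ≡ (a - + 2) - X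
  split-subtrahend = solve-∀
  shift-by-2 : ∀ t → a - + (2 ℕ.* ℕ.suc t) ≡ (a - + 2) - + (2 ℕ.* t)
  shift-by-2 t = trans (cong (λ m → a - + m) (ℕ.*-suc 2 t)) (split-subtrahend a (+ (2 ℕ.* t)))
  closed-form : ∀ a K → a - + 0 + K * ((a - + 2) - K + + 1) ≡ (+ 1 + K) * (a - (+ 1 + K) + + 1)
  closed-form = solve-∀

g-coefficients-sum : ∀ k → sumℤ (map (λ j → + (k ℕ.∸ 1) - + (2 ℕ.* toℕ j)) (allFin k)) ≡ + 0
g-coefficients-sum ℕ.zero    = refl
g-coefficients-sum (ℕ.suc k) = begin
  sumℤ (map (λ j → + k - + (2 ℕ.* toℕ j)) (allFin (ℕ.suc k)))
    ≡⟨ sumℤ-arithmeticProgression (+ k) (ℕ.suc k) ⟩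
  + ℕ.suc k * (+ k - (+ 1 + + k) + + 1)  ≡⟨ cong (+ ℕ.suc k *_) (cancel (+ k)) ⟩
  + ℕ.suc k * + 0                         ≡⟨ ℤ.*-zeroʳ (+ ℕ.suc k) ⟩
  + 0                                     ∎
  where
  cancel : ∀ K → K - (+ 1 + K) + + 1 ≡ + 0
  cancel = solve-∀

g-shift : ∀ {k s} {x y : Point k} → Shifted s x y → g k x ≡ g k y
g-shift {k} {s} {x} {y} x≈y = begin
  g k x
    ≡⟨ cong sumℤ (map-cong (λ j → cong (λ n → w j * + n) (coordinate x≈y j)) (allFin k)) ⟩
  sumℤ (map (λ j → w j * (+ s + + y j)) (allFin k))
    ≡⟨ sumℤ-map-*-+ w (+ s) (λ j → + y j) (allFin k) ⟩
  + s * sumℤ (map w (allFin k)) + g k y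
    ≡⟨ cong (λ S → + s * S + g k y) (g-coefficients-sum k) ⟩
  + s * + 0 + g k y
    ≡⟨ cong (_+ g k y) (ℤ.*-zeroʳ (+ s)) ⟩
  + 0 + g k y
    ≡⟨ ℤ.+-identityˡ (g k y) ⟩
  g k y ∎
  where
  w : Fin k → ℤ
  w j = + (k ℕ.∸ 1) - + (2 ℕ.* toℕ j)

sswtFrom-shift : ∀ {k} (b : ℕ → ℤ) {s} {x y : Point k} → Shifted s x y →
                 ∀ p → sswtFrom b x p ≡ sswtFrom b y p
sswtFrom-shift b x≈y []      = refl
sswtFrom-shift b x≈y (i ∷ p) =
  cong₂ (λ h w → (if isUpStep i then b ℤ.∣ h ∣ else + 1) * w)
        (g-shift x≈y) (sswtFrom-shift b (step-shift x≈y i) p)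

concatMap-map≡cartesianProductWith : ∀ {A B C : Set} (f : A → B → C) xs ys →
  concatMap (λ x → map (f x) ys) xs ≡ cartesianProductWith f xs ys
concatMap-map≡cartesianProductWith f []       ys = refl
concatMap-map≡cartesianProductWith f (x ∷ xs) ys =
  cong (map (f x) ys ++_) (concatMap-map≡cartesianProductWith f xs ys)

words-suc : ∀ k m → words k (ℕ.suc m) ≡ cartesianProductWith (flip _∷_) (words k m) (allFin k)
words-suc k m = concatMap-map≡cartesianProductWith (flip _∷_) (words k m) (allFin k)

words-unique : ∀ k m → Unique (words k m)
words-unique k ℕ.zero    = [] ∷ []
words-unique k (ℕ.suc m) rewrite words-suc k m =
  cartesianProductWith⁺ (flip _∷_) ∷-injective-swapped (words-unique k m) (allFin⁺ k)
  where
  ∷-injective-swapped : ∀ {w x : Path k} {i j} → i ∷ w ≡ j ∷ x → w ≡ x × i ≡ j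
  ∷-injective-swapped refl = refl , refl

∈-words : ∀ {k} (w : Path k) → w ∈ words k (length w)
∈-words []      = here refl
∈-words {k} (i ∷ w) rewrite words-suc k (length w) =
  ∈-cartesianProductWith⁺ (flip _∷_) (∈-words w) (∈-allFin i)

∈-words⇒length : ∀ {k m} {w : Path k} → w ∈ words k m → length w ≡ m
∈-words⇒length {m = ℕ.zero}  (here refl) = refl
∈-words⇒length {k} {ℕ.suc m} w∈ rewrite words-suc k m
  with _ , _ , v∈ , _ , refl ← ∈-cartesianProductWith⁻ (flip _∷_) (words k m) (allFin k) w∈ =
  cong ℕ.suc (∈-words⇒length v∈)

filter-singleton : ∀ {A : Set} {P : A → Set} (P? : Decidable P) {c xs} → Unique xs → c ∈ xs → P c →
                   (∀ {x} → x ∈ xs → P x → x ≡ c) → filter P? xs ≡ c ∷ []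
filter-singleton P? (x∉ ∷ _) (here refl) Pc only-c =
  trans (filter-accept P? Pc)
        (cong (_ ∷_) (filter-none P? (All.tabulate λ x∈ Px → All.lookup x∉ x∈ (sym (only-c (there x∈) Px)))))
filter-singleton P? (x∉ ∷ xs!) (there c∈) Pc only-c =
  trans (filter-reject P? λ Px → All.lookup x∉ c∈ (only-c (here refl) Px))
        (filter-singleton P? xs! c∈ Pc (only-c ∘ there))

record Admissible k (u : ℕ) (x : Point k) : Set where
  constructor admissible
  field
    weaklyDecreasing : T (isWeaklyDecreasing x)
    bounded          : g k x ℤ.≤ + u

open Admissible

admissible? : ∀ {k} u (x : Point k) → Dec (Admissible k u x)
admissible? {k} u x =
  map′ (uncurry admissible) (λ a → weaklyDecreasing a , bounded a)
       (T? (isWeaklyDecreasing x) ×-dec g k x ℤ.≤? + u)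

Admissible-shift : ∀ {k u s} {x y : Point k} → Shifted s x y → Admissible k u x ⇔ Admissible k u y
Admissible-shift {u = u} x≈y = mk⇔
  (λ (admissible w h) → admissible (subst T wd≡ w) (subst (ℤ._≤ + u) g≡ h))
  (λ (admissible w h) → admissible (subst T (sym wd≡) w) (subst (ℤ._≤ + u) (sym g≡) h))
  where
  wd≡ = isWeaklyDecreasing-shift x≈y
  g≡  = g-shift x≈y

Admissible-mono : ∀ {k u v} {x : Point k} → u ℕ.≤ v → Admissible k u x → Admissible k v x
Admissible-mono u≤v (admissible w h) = admissible w (ℤ.≤-trans h (+≤+ u≤v))

module _ {k u : ℕ} {p : Path k} where

  ballot-bounded⇒admissible : T (isBallot p ∧ (heightPath k p ℤ.≤ᵇ + u)) →
                              All (Admissible k u) (points origin p)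
  ballot-bounded⇒admissible h with ballot , below ← Equivalence.to T-∧ h =
    All.zipWith (uncurry admissible)
      (all⁺ isWeaklyDecreasing _ ballot , All.map⁻ (foldr-forcesᵇ ⊔-forces (+ 0) _ (ℤ.≤ᵇ⇒≤ below)))
    where
    ⊔-forces : ∀ a b → a ℤ.⊔ b ℤ.≤ + u → a ℤ.≤ + u × b ℤ.≤ + u
    ⊔-forces a b h = ℤ.i⊔j≤k⇒i≤k a b h , ℤ.i⊔j≤k⇒j≤k a b h

  admissible⇒ballot-bounded : All (Admissible k u) (points origin p) →
                              T (isBallot p ∧ (heightPath k p ℤ.≤ᵇ + u))
  admissible⇒ballot-bounded adm with ballot , below ← All.unzipWith (λ a → weaklyDecreasing a , bounded a) adm =
    Equivalence.from T-∧
      (all⁻ isWeaklyDecreasing ballot , ℤ.≤⇒≤ᵇ (foldr-preservesᵇ {P = ℤ._≤ + u} ℤ.⊔-lub (+≤+ ℕ.z≤n) (All.map⁺ below)))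

All-points-start : ∀ {k} {P : Point k → Set} {x} p → All P (points x p) → P x
All-points-start []      (Px ∷ _) = Px
All-points-start (_ ∷ _) (Px ∷ _) = Px

module CyclicWalk {k} (next : Fin k → Fin k) where

  walk : Fin k → ℕ → Path k
  walk r ℕ.zero    = []
  walk r (ℕ.suc m) = r ∷ walk (next r) m

  length-walk : ∀ r m → length (walk r m) ≡ m
  length-walk r ℕ.zero    = refl
  length-walk r (ℕ.suc m) = cong ℕ.suc (length-walk (next r) m)

  module _ {At : Fin k → Point k → Set} (advance : ∀ {r x} → At r x → At (next r) (step x r))
           {Adm : Point k → Set} where

    walk-unique : (∀ {r x} i → At r x → Adm (step x i) → i ≡ r) →
                  ∀ {r x} p → At r x → All Adm (points x p) → p ≡ walk r (length p)
    walk-unique forced []      _  _          = refl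
    walk-unique forced (i ∷ p) at (_ ∷ adm) with refl ← forced i at (All-points-start p adm) =
      cong (i ∷_) (walk-unique forced p (advance at) adm)

    walk-admissible : (∀ {r x} → At r x → Adm (step x r)) →
                      ∀ {r x} m → At r x → Adm x → All Adm (points x (walk r m))
    walk-admissible safe ℕ.zero    _  admₓ = admₓ ∷ []
    walk-admissible safe (ℕ.suc m) at admₓ = admₓ ∷ walk-admissible safe m (advance at) (safe at)

pattern e₁ = Fin.zero
pattern e₂ = Fin.suc e₁
pattern e₃ = Fin.suc e₂
pattern e₄ = Fin.suc e₃
pattern e₅ = Fin.suc e₄

next : Fin 5 → Fin 5
next e₁ = e₂
next e₂ = e₃
next e₃ = e₄
next e₄ = e₅
next e₅ = e₁

open CyclicWalk next

cyclePoint : Fin 5 → Point 5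
cyclePoint r j = if toℕ r ℕ.≤ᵇ toℕ j then 0 else 1

carry : Fin 5 → ℕ
carry e₅ = 1
carry _  = 0

cyclePoint-step : ∀ r → Shifted (carry r) (step (cyclePoint r) r) (cyclePoint (next r))
cyclePoint-step r =
  shifted (from-yes (all? λ r → all? λ j → step (cyclePoint r) r j ℕ.≟ carry r ℕ.+ cyclePoint (next r) j) r)

cyclePoint-forced : ∀ r i → Admissible 5 7 (step (cyclePoint r) i) → i ≡ r
cyclePoint-forced = from-yes (all? λ r → all? λ i → admissible? 7 (step (cyclePoint r) i) →-dec i Fin.≟ r)

cyclePoint-admissible : ∀ r → Admissible 5 6 (step (cyclePoint r) r)
cyclePoint-admissible = from-yes (all? λ r → admissible? 6 (step (cyclePoint r) r))

data AtCycle (r : Fin 5) (x : Point 5) : Set where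
  atCycle : ∀ s → Shifted s x (cyclePoint r) → AtCycle r x

AtCycle-origin : AtCycle e₁ origin
AtCycle-origin = atCycle 0 (shifted λ _ → refl)

advance : ∀ {r x} → AtCycle r x → AtCycle (next r) (step x r)
advance {r} (atCycle s x≈y) = atCycle (s ℕ.+ carry r) $ Shifted-trans (step-shift x≈y r) (cyclePoint-step r)

admissible-path≡walk : ∀ {u} p → u ℕ.≤ 7 → All (Admissible 5 u) (points origin p) → p ≡ walk e₁ (length p)
admissible-path≡walk p u≤7 adm =
  walk-unique {At = AtCycle} advance forced p AtCycle-origin (All.map (Admissible-mono u≤7) adm)
  where
  forced : ∀ {r x} i → AtCycle r x → Admissible 5 7 (step x i) → i ≡ r
  forced i (atCycle _ x≈y) adm = cyclePoint-forced _ i (Equivalence.to (Admissible-shift (step-shift x≈y i)) adm)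

canonicalPath : ℕ → Path 5
canonicalPath n = walk e₁ (5 ℕ.* n)

canonicalPath-suc : ∀ n → canonicalPath (ℕ.suc n) ≡ e₁ ∷ e₂ ∷ e₃ ∷ e₄ ∷ e₅ ∷ canonicalPath n
canonicalPath-suc n = cong (walk e₁) (ℕ.*-suc 5 n)

canonicalPath-admissible : ∀ {u} n → 6 ℕ.≤ u → All (Admissible 5 u) (points origin (canonicalPath n))
canonicalPath-admissible n 6≤u =
  All.map (Admissible-mono 6≤u)
    (walk-admissible {At = AtCycle} advance safe (5 ℕ.* n) AtCycle-origin (admissible _ (+≤+ ℕ.z≤n)))
  where
  safe : ∀ {r x} → AtCycle r x → Admissible 5 6 (step x r)
  safe {r} (atCycle _ x≈y) = Equivalence.from (Admissible-shift (step-shift x≈y r)) (cyclePoint-admissible r)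

canonicalPath-balanced : ∀ n → T (isBalanced n (canonicalPath n))
canonicalPath-balanced ℕ.zero    = _
canonicalPath-balanced (ℕ.suc n) =
  subst (T ∘ isBalanced (ℕ.suc n)) (sym (canonicalPath-suc n)) (canonicalPath-balanced n)

sswtFrom-canonicalPath : ∀ (b : ℕ → ℤ) n {x} → AtCycle e₁ x → sswtFrom b x (canonicalPath n) ≡ (b 0 * b 4) ^ n
sswtFrom-canonicalPath b ℕ.zero    _        = refl
sswtFrom-canonicalPath b (ℕ.suc n) {x} (atCycle _ x≈y) = begin
  sswtFrom b x (canonicalPath (ℕ.suc n))
    ≡⟨ cong (sswtFrom b x) (canonicalPath-suc n) ⟩
  sswtFrom b x (e₁ ∷ e₂ ∷ e₃ ∷ e₄ ∷ e₅ ∷ canonicalPath n)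
    ≡⟨ sswtFrom-shift b x≈y (e₁ ∷ e₂ ∷ e₃ ∷ e₄ ∷ e₅ ∷ canonicalPath n) ⟩
  sswtFrom b (cyclePoint e₁) (e₁ ∷ e₂ ∷ e₃ ∷ e₄ ∷ e₅ ∷ canonicalPath n)
    ≡⟨ cong (λ w → b 0 * (b 4 * (+ 1 * (+ 1 * (+ 1 * w))))) (sswtFrom-canonicalPath b n back-at-e₁) ⟩
  b 0 * (b 4 * (+ 1 * (+ 1 * (+ 1 * (b 0 * b 4) ^ n))))
    ≡⟨ regroup (b 0) (b 4) ((b 0 * b 4) ^ n) ⟩
  (b 0 * b 4) ^ ℕ.suc n ∎
  where
  back-at-e₁ : AtCycle e₁ (step (step (step (step (step (cyclePoint e₁) e₁) e₂) e₃) e₄) e₅)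
  back-at-e₁ = atCycle 1 $ shifted λ { e₁ → refl ; e₂ → refl ; e₃ → refl ; e₄ → refl ; e₅ → refl }
  regroup : ∀ a c w → a * (c * (+ 1 * (+ 1 * (+ 1 * w)))) ≡ a * c * w
  regroup = solve-∀

boundedBallotPaths-5-singleton : ∀ {u} n → 6 ℕ.≤ u → u ℕ.≤ 7 → boundedBallotPaths 5 u n ≡ canonicalPath n ∷ []
boundedBallotPaths-5-singleton {u} n 6≤u u≤7 =
  filter-singleton (T? ∘ accepted) (words-unique 5 (5 ℕ.* n)) canonical∈ canonical-accepted only-canonical
  where
  accepted : Path 5 → Bool
  accepted p = isBalanced n p ∧ isBallot p ∧ (heightPath 5 p ℤ.≤ᵇ + u)

  canonical∈ : canonicalPath n ∈ words 5 (5 ℕ.* n)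
  canonical∈ = subst (λ m → canonicalPath n ∈ words 5 m) (length-walk e₁ (5 ℕ.* n)) (∈-words (canonicalPath n))

  canonical-accepted : T (accepted (canonicalPath n))
  canonical-accepted = Equivalence.from T-∧
    (canonicalPath-balanced n , admissible⇒ballot-bounded (canonicalPath-admissible n 6≤u))

  only-canonical : ∀ {p} → p ∈ words 5 (5 ℕ.* n) → T (accepted p) → p ≡ canonicalPath n
  only-canonical {p} p∈ h = begin
    p
      ≡⟨ admissible-path≡walk p u≤7 (ballot-bounded⇒admissible (proj₂ (Equivalence.to (T-∧ {isBalanced n p}) h))) ⟩
    walk e₁ (length p)
      ≡⟨ cong (walk e₁) (∈-words⇒length p∈) ⟩
    canonicalPath n ∎

Chat-5≡power : ∀ b {u} n → 6 ℕ.≤ u → u ℕ.≤ 7 → Chat b 5 u n ≡ (b 0 * b 4) ^ n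
Chat-5≡power b {u} n 6≤u u≤7 = begin
  Chat b 5 u n                         ≡⟨ cong (sumℤ ∘ map (sswt b)) (boundedBallotPaths-5-singleton n 6≤u u≤7) ⟩
  sswt b (canonicalPath n) + + 0       ≡⟨ ℤ.+-identityʳ _ ⟩
  sswtFrom b origin (canonicalPath n)  ≡⟨ sswtFrom-canonicalPath b n AtCycle-origin ⟩
  (b 0 * b 4) ^ n                      ∎

proposition4p7 : (b : ℕ → ℤ) (n : ℕ) → 1 ≤ n →
    (Chat b 5 6 n ≡ (b 0 * b 4) ^ n) × (Chat b 5 7 n ≡ (b 0 * b 4) ^ n)
proposition4p7 b n _ = Chat-5≡power b n ℕ.≤-refl (ℕ.n≤1+n 6) , Chat-5≡power b n (ℕ.n≤1+n 6) ℕ.≤-refl
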